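{- Let $n$ and $m$ be integers with $m\leq n/11$. Every tournament $T$ on $n$ vertices contains two disjoint sets of vertices $\{x_1,\dots,x_m\}$ and $\{y_1,\dots,y_m\}$ such that for any permutation $\sigma$ of $\{1,\dots,m\}$, there are vertex-disjoint directed paths $P_1,\dots,P_m$ in $T$ such that $P_i$ goes from $x_i$ to $y_{\sigma(i)}$ for each $i$.
   Context: A tournament is a directed graph with exactly one directed edge between any two distinct vertices. A directed path is a sequence of distinct vertices $v_1,\dots,v_r$ with $v_jv_{j+1}$ an edge for all $j<r$; it goes from $v_1$ to $v_r$. -}

module Defs where

open import Data.Nat using (ℕ)
open import Data.Fin using (Fin)
open import Data.Bool using (Bool; true; false)
open import Data.List using (List; []; _∷_)
open import Data.List.Relation.Unary.Unique.Propositional using (Unique)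
open import Data.List.Membership.Propositional using (_∈_)
open import Data.Product using (Σ; _×_)
open import Relation.Binary.PropositionalEquality using (_≡_; _≢_)
open import Relation.Nullary using (¬_)
open import Data.Sum using (_⊎_)
open import Data.Empty using (⊥)

record Tournament (n : ℕ) : Set where
  field
    adj      : Fin n → Fin n → Bool
    loopless : ∀ u → adj u u ≡ false
    oneEdge  : ∀ u v → u ≢ v → (adj u v ≡ true × adj v u ≡ false)
                               ⊎ (adj u v ≡ false × adj v u ≡ true)

open Tournament public

data WalkFromTo {n : ℕ} (T : Tournament n) : List (Fin n) → Fin n → Fin n → Set where
  single : ∀ a → WalkFromTo T (a ∷ []) a a
  step   : ∀ {vs} a {b c} → adj T a b ≡ true → WalkFromTo T (b ∷ vs) b c
         → WalkFromTo T (a ∷ b ∷ vs) a c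

IsPath : {n : ℕ} → Tournament n → List (Fin n) → Fin n → Fin n → Set
IsPath T vs a b = WalkFromTo T vs a b × Unique vs

Disjoint : {n : ℕ} → List (Fin n) → List (Fin n) → Set
Disjoint P Q = ∀ v → v ∈ P → v ∈ Q → ⊥

-- If some m vertices all beat some other m vertices, choosing the x's among the former and
-- the y's among the latter makes single arcs the required paths. Otherwise, double counting
-- the arcs inside the set of vertices of out-degree below t shows that this set has at most
-- 2t elements, and likewise for in-degrees; with t = 5m and n ≥ 11m this leaves room to
-- choose disjoint x's of out-degree at least 5m and y's of in-degree at least 5m. The paths
-- are then built greedily, one pair at a time: fewer than 4m vertices are used so far, so
-- x_i has a set A of m unused out-neighbours and y_σ(i) a set B of m unused in-neighbours.
-- A common vertex of A and B, or an arc from A to B, gives a path with at most two inner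
-- vertices; if there is neither, B dominates A, which we excluded.
module Submission where

open import Defs
open import Level using (Level; 0ℓ)
open import Data.Bool using (true; if_then_else_)
import Data.Bool as Bool
open import Data.Fin using (Fin; zero; suc)
open import Data.Fin.Permutation using (Permutation′; _⟨$⟩ʳ_; _⟨$⟩ˡ_; inverseˡ)
open import Data.Fin.Properties using (_≟_; suc-injective; any?; all?)
open import Data.Fin.Subset using (Subset) renaming (_∈_ to _∈ₛ_)
open import Data.Fin.Subset.Properties using (anySubset?) renaming (_∈?_ to _∈ₛ?_)
open import Data.List using (List; []; _∷_; _++_; length; foldr; allFin)
open import Data.List.Membership.Propositional using (_∈_)
open import Data.List.Membership.Propositional.Properties using (∈-++⁻; ∈-allFin)
open import Data.List.Properties using (length-tabulate)
open import Data.List.Relation.Unary.All using (All; []; _∷_)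
import Data.List.Relation.Unary.All as All
open import Data.List.Relation.Unary.AllPairs using ([]; _∷_)
open import Data.List.Relation.Unary.Any using (here; there)
open import Data.Maybe using (Maybe; just; nothing; _<∣>_)
import Data.Maybe as Maybe
open import Data.Maybe.Properties using (≡-dec; just-injective)
open import Data.Nat using (ℕ; zero; suc; _+_; _*_; _≤_; _<_; z≤n; s≤s; _≤?_)
open import Data.Nat.Properties
  using ( module ≤-Reasoning; ≤-refl; ≤-trans; ≤-reflexive; ≤-antisym; ≤-pred; <⇒≤; ≰⇒>
        ; +-comm; +-assoc; +-identityʳ; +-mono-≤; +-monoˡ-≤; +-monoʳ-≤; +-cancelˡ-≤; +-cancelʳ-≤
        ; m≤m+n; m≤n+m; *-identityʳ; *-zeroʳ; *-suc; *-distribˡ-+; *-cancelˡ-≤; +-*-semiring )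
open import Algebra.Properties.Semiring.Sum +-*-semiring
  using (sum; sum-cong-≗; ∑-distrib-+; ∑-comm; *-distribˡ-sum; *-distribʳ-sum)
open import Data.Nat.Tactic.RingSolver using (solve-∀)
open import Data.Product using (Σ; ∃; _×_; _,_; proj₁; proj₂)
open import Data.Sum using (_⊎_; inj₁; inj₂)
open import Data.Vec using (tabulate)
import Data.Vec.Functional as Vector
open import Data.Vec.Functional.Properties using (updateAt-updates; updateAt-minimal)
open import Data.Vec.Properties using (lookup∘tabulate; []=⇒lookup; lookup⇒[]=)
open import Function using (_∘_; const; id)
open import Function.Definitions using (Injective)
open import Relation.Binary.PropositionalEquality
open import Relation.Nullary using (Dec; yes; no; does; ¬_; contradiction)
open import Relation.Nullary.Decidable using (dec⇒maybe; _×-dec_; _→-dec_; dec-true)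
open import Relation.Unary using (Pred; Decidable; _⊆_; _∪_; _∩_)
open import Relation.Unary.Properties using (∁?; _∪?_; _∩?_)

private variable
  ℓ ℓ′ : Level
  m n : ℕ

indicator : {A : Set ℓ} → Dec A → ℕ
indicator a? = if does a? then 1 else 0

count : {P : Pred (Fin n) ℓ} → Decidable P → ℕ
count P? = sum (indicator ∘ P?)

sum-mono-≤ : {f g : Fin n → ℕ} → (∀ v → f v ≤ g v) → sum f ≤ sum g
sum-mono-≤ {zero}  f≤g = z≤n
sum-mono-≤ {suc n} f≤g = +-mono-≤ (f≤g zero) (sum-mono-≤ (λ v → f≤g (suc v)))

sum-const : ∀ n c → sum {n} (λ _ → c) ≡ n * c
sum-const zero    c = refl
sum-const (suc n) c = cong (c +_) (sum-const n c)

module _ {P : Pred (Fin n) ℓ} {Q : Pred (Fin n) ℓ′} (P? : Decidable P) (Q? : Decidable Q) where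

  count-mono : P ⊆ Q → count P? ≤ count Q?
  count-mono P⊆Q = sum-mono-≤ pointwise
    where
    pointwise : ∀ v → indicator (P? v) ≤ indicator (Q? v)
    pointwise v with P? v | Q? v
    ... | no _  | _     = z≤n
    ... | yes _ | yes _ = ≤-refl
    ... | yes p | no ¬q = contradiction (P⊆Q p) ¬q

  count-∪ : count (P? ∪? Q?) ≤ count P? + count Q?
  count-∪ = ≤-trans (sum-mono-≤ pointwise) (≤-reflexive (∑-distrib-+ (indicator ∘ P?) (indicator ∘ Q?)))
    where
    pointwise : ∀ v → indicator ((P? ∪? Q?) v) ≤ indicator (P? v) + indicator (Q? v)
    pointwise v with P? v | Q? v
    ... | yes _ | _     = s≤s z≤n
    ... | no _  | yes _ = ≤-refl
    ... | no _  | no _  = z≤n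

  count-split : count P? ≡ count (P? ∩? Q?) + count (P? ∩? ∁? Q?)
  count-split = trans (sum-cong-≗ pointwise)
                      (∑-distrib-+ (indicator ∘ (P? ∩? Q?)) (indicator ∘ (P? ∩? ∁? Q?)))
    where
    pointwise : ∀ v → indicator (P? v) ≡ indicator ((P? ∩? Q?) v) + indicator ((P? ∩? ∁? Q?) v)
    pointwise v with P? v | Q? v
    ... | yes _ | yes _ = refl
    ... | yes _ | no _  = refl
    ... | no _  | _     = refl

count-cong : {P : Pred (Fin n) ℓ} {Q : Pred (Fin n) ℓ′} (P? : Decidable P) (Q? : Decidable Q) →
             P ⊆ Q → Q ⊆ P → count P? ≡ count Q?
count-cong P? Q? P⊆Q Q⊆P = ≤-antisym (count-mono P? Q? P⊆Q) (count-mono Q? P? Q⊆P)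

count-∁ : {P : Pred (Fin n) ℓ} (P? : Decidable P) → count P? + count (∁? P?) ≡ n
count-∁ {n} P? = begin
  count P? + count (∁? P?)                            ≡⟨ ∑-distrib-+ (indicator ∘ P?) (indicator ∘ ∁? P?) ⟨
  sum (λ v → indicator (P? v) + indicator (∁? P? v))  ≡⟨ sum-cong-≗ pointwise ⟩
  sum {n} (λ _ → 1)                                   ≡⟨ sum-const n 1 ⟩
  n * 1                                               ≡⟨ *-identityʳ n ⟩
  n                                                   ∎
  where
  open ≡-Reasoning
  pointwise : ∀ v → indicator (P? v) + indicator (∁? P? v) ≡ 1
  pointwise v with P? v
  ... | yes _ = refl
  ... | no _  = refl

count-∅ : {P : Pred (Fin n) ℓ} (P? : Decidable P) → (∀ v → ¬ P v) → count P? ≡ 0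
count-∅ {n} P? ∅ = trans (sum-cong-≗ pointwise) (trans (sum-const n 0) (*-zeroʳ n))
  where
  pointwise : ∀ v → indicator (P? v) ≡ 0
  pointwise v with P? v
  ... | yes p = contradiction p (∅ v)
  ... | no _  = refl

count-≡ : (w : Fin n) → count (_≟ w) ≡ 1
count-≡ {suc n} zero    = cong suc (count-∅ {n = n} (λ v → suc v ≟ zero) (λ _ ()))
count-≡ {suc n} (suc w) =
  trans (count-cong (λ v → suc v ≟ suc w) (_≟ w) suc-injective (cong suc)) (count-≡ w)

choose : {P : Pred (Fin n) ℓ} (P? : Decidable P) → m ≤ count P? →
         Σ (Fin m → Fin n) λ e → Injective _≡_ _≡_ e × (∀ i → P (e i))
choose {m = zero} P? _ = (λ ()) , (λ { {()} }) , λ ()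
choose {zero} {m = suc m} P? ()
choose {suc n} {m = suc m} P? m≤count with P? zero
... | no _ = let e , e-injective , e∈P = choose (P? ∘ suc) m≤count in
  suc ∘ e , e-injective ∘ suc-injective , e∈P
... | yes p = let e , e-injective , e∈P = choose (P? ∘ suc) (≤-pred m≤count) in
  (zero Vector.∷ suc ∘ e) , injective e-injective , λ { zero → p ; (suc i) → e∈P i }
  where
  injective : {e : Fin m → Fin n} → Injective _≡_ _≡_ e → Injective _≡_ _≡_ (zero Vector.∷ suc ∘ e)
  injective e-injective {zero}  {zero}  _  = refl
  injective e-injective {suc i} {suc j} eq = cong suc (e-injective (suc-injective eq))

Image : (Fin m → Fin n) → Pred (Fin n) 0ℓ
Image f v = ∃ λ i → f i ≡ v

image? : (f : Fin m → Fin n) → Decidable (Image f)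
image? f v = any? (λ i → f i ≟ v)

count-image : (f : Fin m → Fin n) → count (image? f) ≤ m
count-image {zero}  f = ≤-reflexive (count-∅ (image? f) λ _ ())
count-image {suc m} f = begin
  count (image? f)                        ≤⟨ count-mono (image? f) (head? ∪? image? (f ∘ suc)) split ⟩
  count (head? ∪? image? (f ∘ suc))       ≤⟨ count-∪ head? (image? (f ∘ suc)) ⟩
  count head? + count (image? (f ∘ suc))  ≤⟨ +-mono-≤ (≤-reflexive (count-≡ (f zero)))
                                                      (count-image (f ∘ suc)) ⟩
  1 + m                                   ∎
  where
  open ≤-Reasoning
  head? : Decidable (_≡ f zero)
  head? = _≟ f zero
  split : Image f ⊆ (_≡ f zero) ∪ Image (f ∘ suc)
  split (zero  , refl) = inj₁ refl
  split (suc i , refl) = inj₂ (i , refl)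

preimage : (Fin m → Fin n) → Fin n → Maybe (Fin m)
preimage f v = Maybe.map proj₁ (dec⇒maybe (image? f v))

preimage-sound : (f : Fin m → Fin n) {v : Fin n} {i : Fin m} → preimage f v ≡ just i → f i ≡ v
preimage-sound f {v} eq with image? f v
preimage-sound f refl | yes (i , fi≡v) = fi≡v

preimage-outside : (f : Fin m → Fin n) {v : Fin n} → ¬ Image f v → preimage f v ≡ nothing
preimage-outside f {v} v∉f with image? f v
... | yes v∈f = contradiction v∈f v∉f
... | no _    = refl

preimage-injective : {f : Fin m → Fin n} → Injective _≡_ _≡_ f → ∀ i → preimage f (f i) ≡ just i
preimage-injective {f = f} f-injective i with image? f (f i)
... | yes (j , fj≡fi) = cong just (f-injective fj≡fi)
... | no fi∉f         = contradiction (i , refl) fi∉f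

square-bound : ∀ {s e} t → e + e + s ≡ s * s → e + s ≤ s * t → s ≤ t + t
square-bound {zero}  t _ _ = z≤n
square-bound {suc s} {e} t total bound = <⇒≤ (*-cancelˡ-≤ (suc s) (begin
  suc s * suc (suc s)        ≡⟨ *-suc (suc s) (suc s) ⟩
  suc s + suc s * suc s      ≡⟨ cong (suc s +_) total ⟨
  suc s + (e + e + suc s)    ≡⟨ rearrange (suc s) e ⟩
  (e + suc s) + (e + suc s)  ≤⟨ +-mono-≤ bound bound ⟩
  suc s * t + suc s * t      ≡⟨ *-distribˡ-+ (suc s) t t ⟨
  suc s * (t + t)            ∎))
  where
  open ≤-Reasoning
  rearrange : ∀ a e → a + (e + e + a) ≡ (e + a) + (e + a)
  rearrange = solve-∀

opposite : Tournament n → Tournament n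
opposite T = record
  { adj      = λ u v → adj T v u
  ; loopless = loopless T
  ; oneEdge  = λ u v u≢v → oneEdge T v u (u≢v ∘ sym)
  }

Arc : Tournament n → Fin n → Fin n → Set
Arc T u v = adj T u v ≡ true

arc? : (T : Tournament n) → ∀ u v → Dec (Arc T u v)
arc? T u v = adj T u v Bool.≟ true

outdeg indeg : Tournament n → Fin n → ℕ
outdeg T u = count (arc? T u)
indeg T = outdeg (opposite T)

arc⇒≢ : (T : Tournament n) {u v : Fin n} → Arc T u v → u ≢ v
arc⇒≢ T {u} uv refl with () ← trans (sym uv) (loopless T u)

arc-or-reverse : (T : Tournament n) {u v : Fin n} → u ≢ v → ¬ Arc T v u → Arc T u v
arc-or-reverse T {u} {v} u≢v ¬vu with oneEdge T u v u≢v
... | inj₁ (uv , _) = uv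
... | inj₂ (_ , vu) = contradiction vu ¬vu

arc-trichotomy : (T : Tournament n) (u v : Fin n) →
                 indicator (arc? T u v) + indicator (arc? T v u) + indicator (v ≟ u) ≡ 1
arc-trichotomy T u v with v ≟ u
... | yes refl rewrite loopless T u = refl
... | no v≢u with oneEdge T u v (v≢u ∘ sym)
...   | inj₁ (uv , vu) rewrite uv | vu = refl
...   | inj₂ (uv , vu) rewrite uv | vu = refl

outdeg+indeg : (T : Tournament n) (u : Fin n) → outdeg T u + indeg T u + 1 ≡ n
outdeg+indeg {n} T u = begin
  outdeg T u + indeg T u + 1
    ≡⟨ cong (outdeg T u + indeg T u +_) (count-≡ u) ⟨
  outdeg T u + indeg T u + count (_≟ u)
    ≡⟨ cong (_+ count (_≟ u)) (∑-distrib-+ (indicator ∘ arc? T u) (λ v → indicator (arc? T v u))) ⟨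
  sum (λ v → indicator (arc? T u v) + indicator (arc? T v u)) + count (_≟ u)
    ≡⟨ ∑-distrib-+ (λ v → indicator (arc? T u v) + indicator (arc? T v u)) (indicator ∘ (_≟ u)) ⟨
  sum (λ v → indicator (arc? T u v) + indicator (arc? T v u) + indicator (v ≟ u))
    ≡⟨ sum-cong-≗ (arc-trichotomy T u) ⟩
  sum {n} (λ _ → 1)
    ≡⟨ trans (sum-const n 1) (*-identityʳ n) ⟩
  n ∎
  where open ≡-Reasoning

module _ (T : Tournament n) {S : Pred (Fin n) ℓ} (S? : Decidable S) where

  private
    arcWithin : Fin n → Fin n → ℕ
    arcWithin u v = indicator (S? u ×-dec S? v ×-dec arc? T u v)

    arcsWithin : ℕ
    arcsWithin = sum (λ u → sum (arcWithin u))

    pair-trichotomy : ∀ u v → indicator (S? u ×-dec S? v ×-dec arc? T u v)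
                              + indicator (S? v ×-dec S? u ×-dec arc? T v u)
                              + indicator (S? u ×-dec v ≟ u)
                            ≡ indicator (S? u) * indicator (S? v)
    pair-trichotomy u v with S? u | S? v
    ... | yes _  | yes _ = arc-trichotomy T u v
    ... | no _   | yes _ = refl
    ... | no _   | no _  = refl
    ... | yes su | no sv with v ≟ u
    ...   | yes refl = contradiction su sv
    ...   | no _     = refl

    count-diagonal : ∀ u → count (λ v → S? u ×-dec v ≟ u) ≡ indicator (S? u)
    count-diagonal u with S? u
    ... | yes su = trans (count-cong (λ v → yes su ×-dec v ≟ u) (_≟ u) proj₂ (su ,_)) (count-≡ u)
    ... | no ¬su = count-∅ (λ v → no ¬su ×-dec v ≟ u) (λ _ → ¬su ∘ proj₁)

    row : ∀ u → sum (arcWithin u) + sum (λ v → arcWithin v u) + indicator (S? u)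
              ≡ indicator (S? u) * count S?
    row u = begin
      sum (arcWithin u) + sum (λ v → arcWithin v u) + indicator (S? u)
        ≡⟨ cong₂ _+_ (∑-distrib-+ (arcWithin u) (λ v → arcWithin v u)) (count-diagonal u) ⟨
      sum (λ v → arcWithin u v + arcWithin v u) + count (λ v → S? u ×-dec v ≟ u)
        ≡⟨ ∑-distrib-+ (λ v → arcWithin u v + arcWithin v u) (λ v → indicator (S? u ×-dec v ≟ u)) ⟨
      sum (λ v → arcWithin u v + arcWithin v u + indicator (S? u ×-dec v ≟ u))
        ≡⟨ sum-cong-≗ (pair-trichotomy u) ⟩
      sum (λ v → indicator (S? u) * indicator (S? v))
        ≡⟨ *-distribˡ-sum (indicator (S? u)) (indicator ∘ S?) ⟨
      indicator (S? u) * count S? ∎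
      where open ≡-Reasoning

    -- Each arc inside S is counted once at its tail and once at its head.
    handshake : arcsWithin + arcsWithin + count S? ≡ count S? * count S?
    handshake = begin
      arcsWithin + arcsWithin + count S?
        ≡⟨ cong (λ e → arcsWithin + e + count S?) (∑-comm arcWithin) ⟩
      arcsWithin + sum (λ u → sum (λ v → arcWithin v u)) + count S?
        ≡⟨ cong (_+ count S?) (∑-distrib-+ (λ u → sum (arcWithin u)) (λ u → sum (λ v → arcWithin v u))) ⟨
      sum (λ u → sum (arcWithin u) + sum (λ v → arcWithin v u)) + count S?
        ≡⟨ ∑-distrib-+ (λ u → sum (arcWithin u) + sum (λ v → arcWithin v u)) (indicator ∘ S?) ⟨
      sum (λ u → sum (arcWithin u) + sum (λ v → arcWithin v u) + indicator (S? u))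
        ≡⟨ sum-cong-≗ row ⟩
      sum (λ u → indicator (S? u) * count S?)
        ≡⟨ *-distribʳ-sum (count S?) (indicator ∘ S?) ⟨
      count S? * count S? ∎
      where open ≡-Reasoning

    row-bound : (t : ℕ) → (∀ {u} → S u → outdeg T u < t) →
                ∀ u → sum (arcWithin u) + indicator (S? u) ≤ indicator (S? u) * t
    row-bound t low u with S? u
    ... | no ¬su = ≤-reflexive (trans (+-identityʳ _)
                     (count-∅ (λ v → no ¬su ×-dec S? v ×-dec arc? T u v) (λ _ → ¬su ∘ proj₁)))
    ... | yes su = begin
      count (λ v → yes su ×-dec S? v ×-dec arc? T u v) + 1
        ≡⟨ +-comm _ 1 ⟩
      suc (count (λ v → yes su ×-dec S? v ×-dec arc? T u v))
        ≤⟨ s≤s (count-mono (λ v → yes su ×-dec S? v ×-dec arc? T u v) (arc? T u) (proj₂ ∘ proj₂)) ⟩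
      suc (outdeg T u)
        ≤⟨ low su ⟩
      t
        ≡⟨ +-identityʳ t ⟨
      t + 0 ∎
      where open ≤-Reasoning

  count-low-outdegree : (t : ℕ) → (∀ {u} → S u → outdeg T u < t) → count S? ≤ t + t
  count-low-outdegree t low = square-bound t handshake (begin
    arcsWithin + count S?                              ≡⟨ ∑-distrib-+ (λ u → sum (arcWithin u)) (indicator ∘ S?) ⟨
    sum (λ u → sum (arcWithin u) + indicator (S? u))   ≤⟨ sum-mono-≤ (row-bound t low) ⟩
    sum (λ u → indicator (S? u) * t)                   ≡⟨ *-distribʳ-sum t (indicator ∘ S?) ⟨
    count S? * t                                       ∎)
    where open ≤-Reasoning

count-high-outdegree : (T : Tournament n) (t : ℕ) → n ≤ count (λ v → t ≤? outdeg T v) + (t + t)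
count-high-outdegree {n} T t = begin
  n                               ≡⟨ count-∁ high? ⟨
  count high? + count (∁? high?)  ≤⟨ +-monoʳ-≤ (count high?) (count-low-outdegree T (∁? high?) t ≰⇒>) ⟩
  count high? + (t + t)           ∎
  where
  open ≤-Reasoning
  high? : Decidable (λ v → t ≤ outdeg T v)
  high? v = t ≤? outdeg T v

DominatingPair : ℕ → Tournament n → Set
DominatingPair m T = Σ (Subset _) λ p → Σ (Subset _) λ q →
  m ≤ count (_∈ₛ? p) × m ≤ count (_∈ₛ? q) × (∀ u v → u ∈ₛ p → v ∈ₛ q → Arc T u v)

dominatingPair? : (m : ℕ) (T : Tournament n) → Dec (DominatingPair m T)
dominatingPair? m T = anySubset? λ p → anySubset? λ q →
  (m ≤? count (_∈ₛ? p)) ×-dec (m ≤? count (_∈ₛ? q)) ×-dec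
  all? (λ u → all? (λ v → (u ∈ₛ? p) →-dec (v ∈ₛ? q) →-dec arc? T u v))

toSubset : {P : Pred (Fin n) ℓ} → Decidable P → Subset n
toSubset P? = tabulate (does ∘ P?)

module _ {P : Pred (Fin n) ℓ} (P? : Decidable P) where

  ∈-toSubset⁻ : ∀ {v} → v ∈ₛ toSubset P? → P v
  ∈-toSubset⁻ {v} v∈P with P? v | trans (sym ([]=⇒lookup v∈P)) (lookup∘tabulate (does ∘ P?) v)
  ... | yes p | _ = p

  ∈-toSubset⁺ : ∀ {v} → P v → v ∈ₛ toSubset P?
  ∈-toSubset⁺ {v} p =
    lookup⇒[]= v (toSubset P?) (trans (lookup∘tabulate (does ∘ P?) v) (dec-true (P? v) p))

  count-toSubset : count (_∈ₛ? toSubset P?) ≡ count P?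
  count-toSubset = count-cong (_∈ₛ? toSubset P?) P? ∈-toSubset⁻ ∈-toSubset⁺

dominatingPair : {T : Tournament n} {P : Pred (Fin n) ℓ} {Q : Pred (Fin n) ℓ′}
                 (P? : Decidable P) (Q? : Decidable Q) → m ≤ count P? → m ≤ count Q? →
                 (∀ {u v} → P u → Q v → Arc T u v) → DominatingPair m T
dominatingPair P? Q? m≤P m≤Q P⇒Q =
  toSubset P? , toSubset Q? ,
  subst (_ ≤_) (sym (count-toSubset P?)) m≤P ,
  subst (_ ≤_) (sym (count-toSubset Q?)) m≤Q ,
  λ u v u∈P v∈Q → P⇒Q (∈-toSubset⁻ P? u∈P) (∈-toSubset⁻ Q? v∈Q)

module _ {T : Tournament n} {F : Pred (Fin n) ℓ} (F? : Decidable F) (x y : Fin n) where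

  freeOut? : Decidable (Arc T x ∩ F)
  freeOut? = arc? T x ∩? F?

  freeIn? : Decidable ((λ v → Arc T v y) ∩ F)
  freeIn? = (λ v → arc? T v y) ∩? F?

  private
    apart : ∀ {u v} → F u → ¬ F v → u ≢ v
    apart fu ¬fv refl = ¬fv fu

  shortPath : ¬ DominatingPair m T → ¬ F x → ¬ F y → x ≢ y →
              m ≤ count freeOut? → m ≤ count freeIn? →
              Σ (List (Fin n)) λ M → IsPath T (x ∷ M ++ y ∷ []) x y × All F M × length M ≤ 2
  shortPath ¬dominating ¬fx ¬fy x≢y m≤out m≤in with any? (λ w → freeOut? w ×-dec freeIn? w)
  ... | yes (w , (xw , fw) , (wy , _)) =
    w ∷ [] ,
    (step x xw (step w wy (single y)) ,
     (apart fw ¬fx ∘ sym ∷ x≢y ∷ []) ∷ (apart fw ¬fy ∷ []) ∷ [] ∷ []) ,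
    fw ∷ [] , s≤s z≤n
  ... | no ¬common with any? (λ a → any? (λ b → freeOut? a ×-dec freeIn? b ×-dec arc? T a b))
  ...   | yes (a , b , (xa , fa) , (by , fb) , ab) =
    a ∷ b ∷ [] ,
    (step x xa (step a ab (step b by (single y))) ,
     (apart fa ¬fx ∘ sym ∷ apart fb ¬fx ∘ sym ∷ x≢y ∷ []) ∷
     (arc⇒≢ T ab ∷ apart fa ¬fy ∷ []) ∷ (apart fb ¬fy ∷ []) ∷ [] ∷ []) ,
    fa ∷ fb ∷ [] , ≤-refl
  ...   | no ¬bridge =
    contradiction (dominatingPair {T = T} freeIn? freeOut? m≤in m≤out in⇒out) ¬dominating
    where
    -- u ≢ v as otherwise u is a common vertex; ¬ Arc T v u as otherwise v u is a bridge.
    in⇒out : ∀ {u v} → Arc T u y × F u → Arc T x v × F v → Arc T u v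
    in⇒out {u} {v} u-in v-out = arc-or-reverse T
      (λ { refl → ¬common (u , v-out , u-in) })
      (λ vu → ¬bridge (v , u , v-out , u-in , vu))

record Terminals (m : ℕ) (T : Tournament n) : Set where
  field
    x y         : Fin m → Fin n
    x-injective : Injective _≡_ _≡_ x
    y-injective : Injective _≡_ _≡_ y
    x≢y         : ∀ i j → x i ≢ y j

HighDegree : (m : ℕ) (T : Tournament n) → Terminals m T → Set
HighDegree m T τ = (∀ i → 5 * m ≤ outdeg T (x i)) × (∀ j → 5 * m ≤ indeg T (y j))
  where open Terminals τ

dominatingTerminals : {T : Tournament n} → DominatingPair m T →
                      Σ (Terminals m T) λ τ → ∀ i j → Arc T (Terminals.x τ i) (Terminals.y τ j)
dominatingTerminals {T = T} (p , q , m≤p , m≤q , p⇒q) =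
  let x , x-injective , x∈p = choose (_∈ₛ? p) m≤p
      y , y-injective , y∈q = choose (_∈ₛ? q) m≤q
      arcs = λ i j → p⇒q (x i) (y j) (x∈p i) (y∈q j)
  in record { x = x ; y = y ; x-injective = x-injective ; y-injective = y-injective
            ; x≢y = λ i j → arc⇒≢ T (arcs i j) }
   , arcs

module _ {m n : ℕ} (11m≤n : 11 * m ≤ n) (T : Tournament n) where

  private
    t : ℕ
    t = 5 * m

    high? : Decidable (λ v → t ≤ outdeg T v)
    high? v = t ≤? outdeg T v

    11m≡m+[t+t] : 11 * m ≡ m + (t + t)
    11m≡m+[t+t] = lemma m
      where
      lemma : ∀ m → 11 * m ≡ m + (5 * m + 5 * m)
      lemma = solve-∀

    m≤count : ∀ c → n ≤ c + (t + t) → m ≤ c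
    m≤count c n≤c+[t+t] = +-cancelʳ-≤ (t + t) m c (begin
      m + (t + t)  ≡⟨ 11m≡m+[t+t] ⟨
      11 * m       ≤⟨ 11m≤n ⟩
      n            ≤⟨ n≤c+[t+t] ⟩
      c + (t + t)  ∎)
      where open ≤-Reasoning

    low⇒high-indeg : ∀ v → outdeg T v < t → t ≤ indeg T v
    low⇒high-indeg v out<t = +-cancelˡ-≤ t t (indeg T v) (begin
      t + t                         ≤⟨ m≤n+m (t + t) m ⟩
      m + (t + t)                   ≡⟨ 11m≡m+[t+t] ⟨
      11 * m                        ≤⟨ 11m≤n ⟩
      n                             ≡⟨ outdeg+indeg T v ⟨
      outdeg T v + indeg T v + 1    ≡⟨ +-comm (outdeg T v + indeg T v) 1 ⟩
      suc (outdeg T v) + indeg T v  ≤⟨ +-monoˡ-≤ (indeg T v) out<t ⟩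
      t + indeg T v                 ∎)
      where open ≤-Reasoning

    m≤middle : ∀ a b c → a ≤ m → c < m → n ≡ a + b + c → m ≤ b
    m≤middle a b c a≤m c<m n≡a+b+c =
      ≤-trans (m≤m+n m (8 * m)) (+-cancelʳ-≤ (m + m) (9 * m) b (begin
        9 * m + (m + m)  ≡⟨ lemma m ⟩
        11 * m           ≤⟨ 11m≤n ⟩
        n                ≡⟨ n≡a+b+c ⟩
        a + b + c        ≤⟨ +-mono-≤ (+-monoˡ-≤ b a≤m) (<⇒≤ c<m) ⟩
        m + b + m        ≡⟨ lemma′ m b ⟩
        b + (m + m)      ∎))
      where
      open ≤-Reasoning
      lemma : ∀ m → 9 * m + (m + m) ≡ 11 * m
      lemma = solve-∀
      lemma′ : ∀ m b → m + b + m ≡ b + (m + m)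
      lemma′ = solve-∀

  -- With at least m vertices of low out-degree, these have high in-degree and serve as the
  -- y's; otherwise the y's are any vertices of high in-degree, and the x's avoid them.
  highDegreeTerminals : Σ (Terminals m T) (HighDegree m T)
  highDegreeTerminals with m ≤? count (∁? high?)
  ... | yes m≤low =
    let x , x-injective , x-high = choose high? (m≤count (count high?) (count-high-outdegree T t))
        y , y-injective , y-low  = choose (∁? high?) m≤low
    in record { x = x ; y = y ; x-injective = x-injective ; y-injective = y-injective
              ; x≢y = λ i j xi≡yj → y-low j (subst (λ v → t ≤ outdeg T v) xi≡yj (x-high i)) }
     , x-high , λ j → low⇒high-indeg (y j) (≰⇒> (y-low j))
  ... | no low≱m =
    let y , y-injective , y-high = choose (λ v → t ≤? indeg T v)
                                     (m≤count _ (count-high-outdegree (opposite T) t))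
        x , x-injective , x-high = choose (high? ∩? ∁? (image? y)) (m≤middle
          (count (high? ∩? image? y)) (count (high? ∩? ∁? (image? y))) (count (∁? high?))
          (≤-trans (count-mono (high? ∩? image? y) (image? y) proj₂) (count-image y))
          (≰⇒> low≱m)
          (trans (sym (count-∁ high?)) (cong (_+ count (∁? high?)) (count-split high? (image? y)))))
    in record { x = x ; y = y ; x-injective = x-injective ; y-injective = y-injective
              ; x≢y = λ i j xi≡yj → proj₂ (x-high i) (j , sym xi≡yj) }
     , proj₁ ∘ x-high , y-high

≡just⇒≢nothing : {A : Set} {o : Maybe A} {a : A} → o ≡ just a → o ≢ nothing
≡just⇒≢nothing refl ()

free? : (owner : Fin n → Maybe (Fin m)) → Decidable (λ v → owner v ≡ nothing)
free? owner v = ≡-dec _≟_ (owner v) nothing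

claimed : (Fin n → Maybe (Fin m)) → ℕ
claimed owner = count (∁? (free? owner))

claim : Fin m → List (Fin n) → (Fin n → Maybe (Fin m)) → Fin n → Maybe (Fin m)
claim i ws owner = foldr (λ w o → Vector.updateAt o w (const (just i))) owner ws

module _ {i : Fin m} {owner : Fin n → Maybe (Fin m)} where

  claim-∈ : ∀ ws {v} → v ∈ ws → claim i ws owner v ≡ just i
  claim-∈ (w ∷ ws) {v} v∈ws with v ≟ w | v∈ws
  ... | yes refl | _          = updateAt-updates v (claim i ws owner)
  ... | no v≢w   | here v≡w   = contradiction v≡w v≢w
  ... | no v≢w   | there v∈ws = trans (updateAt-minimal v w (claim i ws owner) v≢w) (claim-∈ ws v∈ws)

  claim-∉ : ∀ ws {v} → ¬ v ∈ ws → claim i ws owner v ≡ owner v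
  claim-∉ []       v∉ws = refl
  claim-∉ (w ∷ ws) v∉ws = trans (updateAt-minimal _ w (claim i ws owner) (v∉ws ∘ here))
                                (claim-∉ ws (v∉ws ∘ there))

  claimed-claim : ∀ ws → claimed (claim i ws owner) ≤ claimed owner + length ws
  claimed-claim []       = ≤-reflexive (sym (+-identityʳ _))
  claimed-claim (w ∷ ws) = begin
    claimed (updateAt o w)                 ≤⟨ count-mono (∁? (free? (updateAt o w))) (∁? (free? o) ∪? (_≟ w))
                                                         claimed⊆ ⟩
    count (∁? (free? o) ∪? (_≟ w))         ≤⟨ count-∪ (∁? (free? o)) (_≟ w) ⟩
    claimed o + count (_≟ w)               ≡⟨ cong (claimed o +_) (count-≡ w) ⟩
    claimed o + 1                          ≤⟨ +-monoˡ-≤ 1 (claimed-claim ws) ⟩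
    claimed owner + length ws + 1          ≡⟨ +-assoc (claimed owner) (length ws) 1 ⟩
    claimed owner + (length ws + 1)        ≡⟨ cong (claimed owner +_) (+-comm (length ws) 1) ⟩
    claimed owner + length (w ∷ ws)        ∎
    where
    open ≤-Reasoning
    o : Fin n → Maybe (Fin m)
    o = claim i ws owner
    updateAt : (Fin n → Maybe (Fin m)) → Fin n → Fin n → Maybe (Fin m)
    updateAt o w = Vector.updateAt o w (const (just i))
    claimed⊆ : ∀ {v} → updateAt o w v ≢ nothing → o v ≢ nothing ⊎ v ≡ w
    claimed⊆ {v} claimed-v with v ≟ w
    ... | yes v≡w = inj₂ v≡w
    ... | no v≢w  = inj₁ (subst (_≢ nothing) (updateAt-minimal v w o v≢w) claimed-v)

module Linking {T : Tournament n} (τ : Terminals m T) (σ : Permutation′ m) where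
  open Terminals τ

  ys : Fin m → Fin n
  ys i = y (σ ⟨$⟩ʳ i)

  ys-injective : Injective _≡_ _≡_ ys
  ys-injective {i} {j} ysi≡ysj = begin
    i                   ≡⟨ inverseˡ σ ⟨
    σ ⟨$⟩ˡ (σ ⟨$⟩ʳ i)   ≡⟨ cong (σ ⟨$⟩ˡ_) (y-injective ysi≡ysj) ⟩
    σ ⟨$⟩ˡ (σ ⟨$⟩ʳ j)   ≡⟨ inverseˡ σ ⟩
    j                   ∎
    where open ≡-Reasoning

  Links : Set
  Links = Σ (Fin m → List (Fin n)) λ P →
            (∀ i → IsPath T (P i) (x i) (ys i)) × (∀ i j → i ≢ j → Disjoint (P i) (P j))

  route : Fin m → List (Fin n) → List (Fin n)
  route i M = x i ∷ M ++ ys i ∷ []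

  Linked : (Fin m → List (Fin n)) → Fin m → Set
  Linked inner i = IsPath T (route i (inner i)) (x i) (ys i)

  -- owner v ≡ just i records that v lies on the i-th route.
  record Consistent (owner : Fin n → Maybe (Fin m)) (inner : Fin m → List (Fin n)) : Set where
    field
      owns-x     : ∀ i → owner (x i) ≡ just i
      owns-y     : ∀ i → owner (ys i) ≡ just i
      owns-inner : ∀ i {v} → v ∈ inner i → owner v ≡ just i

    owns-route : ∀ i {v} → v ∈ route i (inner i) → owner v ≡ just i
    owns-route i (here refl) = owns-x i
    owns-route i (there v∈M++y) with ∈-++⁻ (inner i) v∈M++y
    ... | inj₁ v∈M         = owns-inner i v∈M
    ... | inj₂ (here refl) = owns-y i

    routes-disjoint : ∀ i j → i ≢ j → Disjoint (route i (inner i)) (route j (inner j))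
    routes-disjoint i j i≢j v v∈Pi v∈Pj =
      i≢j (just-injective (trans (sym (owns-route i v∈Pi)) (owns-route j v∈Pj)))

  consistent⇒links : {owner : Fin n → Maybe (Fin m)} {inner : Fin m → List (Fin n)} →
                     Consistent owner inner → (∀ i → Linked inner i) → Links
  consistent⇒links {inner = inner} consistent linked =
    (λ i → route i (inner i)) , linked , Consistent.routes-disjoint consistent

  endpointOwner : Fin n → Maybe (Fin m)
  endpointOwner v = preimage x v <∣> preimage ys v

  endpointOwner-consistent : Consistent endpointOwner (λ _ → [])
  endpointOwner-consistent = record
    { owns-x     = λ i → cong (_<∣> preimage ys (x i)) (preimage-injective x-injective i)
    ; owns-y     = λ i → trans (cong (_<∣> preimage ys (ys i)) (preimage-outside x (ys∉x i)))
                               (preimage-injective ys-injective i)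
    ; owns-inner = λ i ()
    }
    where
    ys∉x : ∀ i → ¬ Image x (ys i)
    ys∉x i (j , xj≡ysi) = x≢y j (σ ⟨$⟩ʳ i) xj≡ysi

  claimed-endpointOwner : claimed endpointOwner ≤ m + m
  claimed-endpointOwner = begin
    claimed endpointOwner                 ≤⟨ count-mono (∁? (free? endpointOwner)) (image? x ∪? image? ys)
                                                        claimed⊆ ⟩
    count (image? x ∪? image? ys)         ≤⟨ count-∪ (image? x) (image? ys) ⟩
    count (image? x) + count (image? ys)  ≤⟨ +-mono-≤ (count-image x) (count-image ys) ⟩
    m + m                                 ∎
    where
    open ≤-Reasoning
    claimed⊆ : ∀ {v} → endpointOwner v ≢ nothing → Image x v ⊎ Image ys v
    claimed⊆ {v} claimed-v with preimage x v in eq-x | preimage ys v in eq-y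
    ... | just i  | _       = inj₁ (i , preimage-sound x eq-x)
    ... | nothing | just j  = inj₂ (j , preimage-sound ys eq-y)
    ... | nothing | nothing = contradiction refl claimed-v

  directLinks : (∀ i j → Arc T (x i) (y j)) → Links
  directLinks arcs = consistent⇒links endpointOwner-consistent
    (λ i → step (x i) (arcs i (σ ⟨$⟩ʳ i)) (single (ys i)) , (x≢y i (σ ⟨$⟩ʳ i) ∷ []) ∷ [] ∷ [])

  module Greedy (¬dominating : ¬ DominatingPair m T) (high : HighDegree m T τ) where

    record PartialLinkage (is : List (Fin m)) : Set where
      field
        owner       : Fin n → Maybe (Fin m)
        inner       : Fin m → List (Fin n)
        consistent  : Consistent owner inner
        few-claimed : claimed owner ≤ m + m + (length is + length is)
        linked      : ∀ {i} → i ∈ is → Linked inner i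

    start : PartialLinkage []
    start = record
      { owner       = endpointOwner
      ; inner       = λ _ → []
      ; consistent  = endpointOwner-consistent
      ; few-claimed = ≤-trans claimed-endpointOwner (m≤m+n (m + m) 0)
      ; linked      = λ ()
      }

    module _ {is : List (Fin m)} (L : PartialLinkage is) (i : Fin m) where
      open PartialLinkage L
      open Consistent consistent

      extendBy : (M : List (Fin n)) → IsPath T (route i M) (x i) (ys i) →
                 All (λ v → owner v ≡ nothing) M → length M ≤ 2 → PartialLinkage (i ∷ is)
      extendBy M M-linked M-free |M|≤2 = record
        { owner       = claim i M owner
        ; inner       = inner′
        ; consistent  = record
          { owns-x     = λ j → keeps (owns-x j)
          ; owns-y     = λ j → keeps (owns-y j)
          ; owns-inner = owns-inner′
          }
        ; few-claimed = begin
            claimed (claim i M owner)                    ≤⟨ claimed-claim M ⟩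
            claimed owner + length M                     ≤⟨ +-mono-≤ few-claimed |M|≤2 ⟩
            m + m + (length is + length is) + 2          ≡⟨ lemma m (length is) ⟩
            m + m + (length (i ∷ is) + length (i ∷ is))  ∎
        ; linked      = linked′
        }
        where
        open ≤-Reasoning
        lemma : ∀ m k → m + m + (k + k) + 2 ≡ m + m + (suc k + suc k)
        lemma = solve-∀

        inner′ : Fin m → List (Fin n)
        inner′ = Vector.updateAt inner i (const M)

        keeps : ∀ {v j} → owner v ≡ just j → claim i M owner v ≡ just j
        keeps owned = trans (claim-∉ M (≡just⇒≢nothing owned ∘ All.lookup M-free)) owned

        owns-inner′ : ∀ j {v} → v ∈ inner′ j → claim i M owner v ≡ just j
        owns-inner′ j v∈inner′ with j ≟ i
        ... | yes refl = claim-∈ M (subst (_ ∈_) (updateAt-updates i inner) v∈inner′)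
        ... | no j≢i   = keeps (owns-inner j (subst (_ ∈_) (updateAt-minimal j i inner j≢i) v∈inner′))

        linked′ : ∀ {j} → j ∈ i ∷ is → Linked inner′ j
        linked′ {j} j∈i∷is with j ≟ i | j∈i∷is
        ... | yes refl | _          = subst (λ M′ → IsPath T (route i M′) (x i) (ys i))
                                            (sym (updateAt-updates i inner)) M-linked
        ... | no j≢i   | here j≡i   = contradiction j≡i j≢i
        ... | no j≢i   | there j∈is = subst (λ M′ → IsPath T (route j M′) (x j) (ys j))
                                            (sym (updateAt-minimal j i inner j≢i)) (linked j∈is)

      -- At most 2m + 2|is| < 4m vertices are claimed, so 5m neighbours leave m free ones.
      enough-free : length is < m → {P : Pred (Fin n) ℓ} (P? : Decidable P) →
                    5 * m ≤ count P? → m ≤ count (P? ∩? free? owner)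
      enough-free |is|<m P? 5m≤P = +-cancelʳ-≤ (4 * m) m free (begin
        m + 4 * m                                   ≡⟨ lemma m ⟩
        5 * m                                       ≤⟨ 5m≤P ⟩
        count P?                                    ≡⟨ count-split P? (free? owner) ⟩
        free + count (P? ∩? ∁? (free? owner))       ≤⟨ +-monoʳ-≤ free (count-mono (P? ∩? ∁? (free? owner))
                                                                                 (∁? (free? owner)) proj₂) ⟩
        free + claimed owner                        ≤⟨ +-monoʳ-≤ free (≤-trans few-claimed
                                                         (+-monoʳ-≤ (m + m) (+-mono-≤ |is|≤m |is|≤m))) ⟩
        free + (m + m + (m + m))                    ≡⟨ cong (free +_) (lemma′ m) ⟩
        free + 4 * m                                ∎)
        where
        open ≤-Reasoning
        free : ℕ
        free = count (P? ∩? free? owner)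
        |is|≤m : length is ≤ m
        |is|≤m = <⇒≤ |is|<m
        lemma : ∀ m → m + 4 * m ≡ 5 * m
        lemma = solve-∀
        lemma′ : ∀ m → m + m + (m + m) ≡ 4 * m
        lemma′ = solve-∀

      extend : length is < m → PartialLinkage (i ∷ is)
      extend |is|<m =
        let M , M-linked , M-free , |M|≤2 =
              shortPath (free? owner) (x i) (ys i) ¬dominating
                (≡just⇒≢nothing (owns-x i)) (≡just⇒≢nothing (owns-y i)) (x≢y i (σ ⟨$⟩ʳ i))
                (enough-free |is|<m (arc? T (x i)) (proj₁ high i))
                (enough-free |is|<m (λ v → arc? T v (ys i)) (proj₂ high (σ ⟨$⟩ʳ i)))
        in extendBy M M-linked M-free |M|≤2

    linkAll : (is : List (Fin m)) → length is ≤ m → PartialLinkage is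
    linkAll []       _      = start
    linkAll (i ∷ is) |is|<m = extend (linkAll is (<⇒≤ |is|<m)) i |is|<m

    greedyLinks : Links
    greedyLinks = consistent⇒links consistent (λ i → linked (∈-allFin i))
      where open PartialLinkage (linkAll (allFin m) (≤-reflexive (length-tabulate id)))

lemma2p1 : (n m : ℕ) → 11 * m ≤ n → (T : Tournament n) →
    Σ (Fin m → Fin n) λ x → Σ (Fin m → Fin n) λ y →
      Injective _≡_ _≡_ x × Injective _≡_ _≡_ y × (∀ i j → x i ≢ y j) ×
      ((σ : Permutation′ m) →
        Σ (Fin m → List (Fin n)) λ P →
          (∀ i → IsPath T (P i) (x i) (y (σ ⟨$⟩ʳ i))) ×
          (∀ i j → i ≢ j → Disjoint (P i) (P j)))
lemma2p1 n m 11m≤n T with dominatingPair? m T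
... | yes dominating =
  let τ , arcs = dominatingTerminals dominating
      open Terminals τ
  in x , y , x-injective , y-injective , x≢y , λ σ → Linking.directLinks τ σ arcs
... | no ¬dominating =
  let τ , high = highDegreeTerminals 11m≤n T
      open Terminals τ
  in x , y , x-injective , y-injective , x≢y , λ σ → Linking.Greedy.greedyLinks τ σ ¬dominating high
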